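{- Let $\mathcal P$ be a regular abstract $n$-polytope whose facets are isomorphic to $\mathcal K$. Then $\mathcal P$ satisfies the Flat Amalgamation Property with respect to its facets if and only if (its flag graph) is a canonical Cayley extension.
   Context: For a regular abstract $n$-polytope $\mathcal P$ with base flag $\Phi$, $\Gamma(\mathcal P)=\langle\rho_0,\dots,\rho_{n-1}\rangle$ with $\rho_i$ the automorphism mapping $\Phi$ to its $i$-adjacent flag, and $\Gamma_{n-1}=\langle\rho_0,\dots,\rho_{n-2}\rangle$ is the stabilizer of the base facet. $\mathcal P$ has the Flat Amalgamation Property (FAP) with respect to its facets if adjoining the relation $\rho_{n-1}=1$ to a presentation of $\Gamma(\mathcal P)$ in terms of $\rho_0,\dots,\rho_{n-1}$ yields a presentation of $\Gamma_{n-1}$ (in terms of $\rho_0,\dots,\rho_{n-2}$); equivalently, $\Gamma(\mathcal P)=N^+_{n-1}\rtimes\Gamma_{n-1}$ where $N^+_{n-1}$ is the normal closure of $\langle\rho_{n-1}\rangle$. The flag graph of $\mathcal P$ is the $n$-maniplex whose vertices are flags, with $\Psi$ and $\Psi^i$ joined by an edge of colour $i$ when they differ exactly in the $i$-face. Facets are components after deleting colour-$(n-1)$ edges; automorphisms act on the right. An $n$-maniplex $\mathcal M$ is a canonical Cayley extension if there is a subgroup $G\le\Gamma(\mathcal M)$ acting regularly (transitively and freely) on the facets such that for every flag $\Psi$ there is $\gamma\in G$ with $\Psi^{n-1}=\Psi\gamma$. -}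

module Defs where

open import Data.Nat using (ℕ; zero; suc) renaming (_<_ to _<ℕ_)
open import Data.Fin using (Fin; zero; suc; toℕ; fromℕ; inject₁) renaming (_<_ to _<F_; _≤_ to _≤F_)
open import Data.List using (List; []; _∷_)
open import Data.Product using (Σ; _×_; _,_; proj₁; proj₂; ∃)
open import Data.Sum using (_⊎_)
open import Data.Bool using (Bool; true; false)
open import Relation.Binary.PropositionalEquality using (_≡_; _≢_; refl; sym; trans; cong)
open import Relation.Nullary using (¬_)

-- Abstract n-polytopes.
-- Ranks -1,0,...,n are encoded as Fin (2 + n): rank r is encoded by r+1.

record RankedPoset (n : ℕ) : Set₁ where
  field
    Face      : Set
    _≤_       : Face → Face → Set
    ≤-refl    : ∀ x → x ≤ x
    ≤-trans   : ∀ {x y z} → x ≤ y → y ≤ z → x ≤ z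
    ≤-antisym : ∀ {x y} → x ≤ y → y ≤ x → x ≡ y
    rank      : Face → Fin (suc (suc n))

module RankedPosetDefs {n : ℕ} (Q : RankedPoset n) where
  open RankedPoset Q public

  _<_ : Face → Face → Set
  x < y = x ≤ y × x ≢ y

  -- Flags: one face of each rank, forming a chain (hence a maximal chain).
  record Flag : Set where
    field
      face    : Fin (suc (suc n)) → Face
      face-rk : ∀ j → rank (face j) ≡ j
      chain   : ∀ {j k} → j ≤F k → face j ≤ face k
  open Flag public

  _≈_ : Flag → Flag → Set
  Φ ≈ Ψ = ∀ j → face Φ j ≡ face Ψ j

  -- position of the rank-i face (i ∈ {0,…,n-1}) in a flag
  idx : Fin n → Fin (suc (suc n))
  idx i = suc (inject₁ i)

  Adj : Fin n → Flag → Flag → Set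
  Adj i Φ Ψ = (∀ j → j ≢ idx i → face Φ j ≡ face Ψ j) × face Φ (idx i) ≢ face Ψ (idx i)

  data Reach (R : Flag → Flag → Set) : Flag → Flag → Set where
    done : ∀ {Φ Ψ} → Φ ≈ Ψ → Reach R Φ Ψ
    step : ∀ {Φ Ψ Λ} → R Φ Ψ → Reach R Ψ Λ → Reach R Φ Λ

record Polytope (n : ℕ) : Set₁ where
  field
    poset : RankedPoset n
  open RankedPosetDefs poset
  field
    rank-mono : ∀ {x y} → x < y → rank x <F rank y
    bottom       : Face
    bottom-least : ∀ x → bottom ≤ x
    bottom-rank  : rank bottom ≡ zero
    top          : Face
    top-greatest : ∀ x → x ≤ top
    top-rank     : rank top ≡ fromℕ (suc n)
    -- gradedness: whenever the rank jumps by more than one, there is a face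
    -- in between (so every maximal chain has exactly one face of each rank)
    graded : ∀ {x y} → x < y → suc (toℕ (rank x)) <ℕ toℕ (rank y) →
             Σ Face λ z → x < z × z < y
    diamond : ∀ {x y} → x < y → toℕ (rank y) ≡ suc (suc (toℕ (rank x))) →
              Σ Face λ z₁ → Σ Face λ z₂ →
                z₁ ≢ z₂ × (x < z₁ × z₁ < y) × (x < z₂ × z₂ < y) ×
                (∀ z → x < z → z < y → z ≡ z₁ ⊎ z ≡ z₂)
    strongly-flag-connected : ∀ (Φ Ψ : Flag) →
      Reach (λ A B → Σ (Fin n) λ i → Adj i A B ×
                     (∀ j → face Φ j ≡ face Ψ j → face B j ≡ face Φ j)) Φ Ψ

FlagOf : ∀ {n} → Polytope n → Set
FlagOf P = RankedPosetDefs.Flag (Polytope.poset P)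

module _ {n : ℕ} (P : Polytope n) where
  open RankedPosetDefs (Polytope.poset P)

  record Aut : Set where
    field
      fun   : Face → Face
      inv   : Face → Face
      fun-inv : ∀ x → fun (inv x) ≡ x
      inv-fun : ∀ x → inv (fun x) ≡ x
      fun-mono : ∀ {x y} → x ≤ y → fun x ≤ fun y
      inv-mono : ∀ {x y} → x ≤ y → inv x ≤ inv y
  open Aut public

  _≈ₐ_ : Aut → Aut → Set
  α ≈ₐ β = ∀ x → fun α x ≡ fun β x

  idAut : Aut
  idAut = record { fun = λ x → x ; inv = λ x → x ; fun-inv = λ _ → refl
                 ; inv-fun = λ _ → refl ; fun-mono = λ p → p ; inv-mono = λ p → p }

  -- product (acting on the right: first α, then β)
  _·_ : Aut → Aut → Aut
  α · β = record
    { fun = λ x → fun β (fun α x)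
    ; inv = λ x → inv α (inv β x)
    ; fun-inv = λ x → trans (cong (fun β) (fun-inv α (inv β x))) (fun-inv β x)
    ; inv-fun = λ x → trans (cong (inv α) (inv-fun β (fun α x))) (inv-fun α x)
    ; fun-mono = λ p → fun-mono β (fun-mono α p)
    ; inv-mono = λ p → inv-mono α (inv-mono β p) }

  _⁻¹ : Aut → Aut
  α ⁻¹ = record { fun = inv α ; inv = fun α ; fun-inv = inv-fun α
                ; inv-fun = fun-inv α ; fun-mono = inv-mono α ; inv-mono = fun-mono α }

  MapsTo : Aut → Flag → Flag → Set
  MapsTo α Φ Ψ = ∀ j → fun α (face Φ j) ≡ face Ψ j

  IsRegular : Set
  IsRegular = ∀ (Φ Ψ : Flag) → Σ Aut λ α → MapsTo α Φ Ψ

  IsDistinguishedGens : Flag → (Fin n → Aut) → Set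
  IsDistinguishedGens Φ ρ = ∀ i → Σ Flag λ Ψ → Adj i Φ Ψ × MapsTo (ρ i) Φ Ψ

  evalWord : {I : Set} → (I → Aut) → List I → Aut
  evalWord ρ []      = idAut
  evalWord ρ (i ∷ w) = ρ i · evalWord ρ w

-- Flat Amalgamation Property (n = suc m), in the semidirect form
-- Γ(P) = N⁺ₙ₋₁ ⋊ Γₙ₋₁.

module _ {m : ℕ} (P : Polytope (suc m)) where
  open RankedPosetDefs (Polytope.poset P)

  lastColour : Fin (suc m)
  lastColour = fromℕ m

  InΓₙ₋₁ : (Fin (suc m) → Aut P) → Aut P → Set
  InΓₙ₋₁ ρ α = Σ (List (Fin m)) λ w → _≈ₐ_ P α (evalWord P (λ k → ρ (inject₁ k)) w)

  conjProd : (Fin (suc m) → Aut P) → List (Aut P × Bool) → Aut P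
  conjProd ρ [] = idAut P
  conjProd ρ ((g , true) ∷ cs)  = _·_ P (_·_ P (_·_ P g (ρ lastColour)) (_⁻¹ P g)) (conjProd ρ cs)
  conjProd ρ ((g , false) ∷ cs) = _·_ P (_·_ P (_·_ P g (_⁻¹ P (ρ lastColour))) (_⁻¹ P g)) (conjProd ρ cs)

  -- N⁺ₙ₋₁ = normal closure of ⟨ρₙ₋₁⟩ in Γ(P)
  InN⁺ : (Fin (suc m) → Aut P) → Aut P → Set
  InN⁺ ρ α = Σ (List (Aut P × Bool)) λ cs → _≈ₐ_ P α (conjProd ρ cs)

  FAP : (Fin (suc m) → Aut P) → Set
  FAP ρ =
    (∀ g ν → InN⁺ ρ ν → InN⁺ ρ (_·_ P (_·_ P (_⁻¹ P g) ν) g)) ×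
    (∀ α → Σ (Aut P) λ ν → Σ (Aut P) λ β →
             InN⁺ ρ ν × InΓₙ₋₁ ρ β × _≈ₐ_ P α (_·_ P ν β)) ×
    (∀ α → InN⁺ ρ α → InΓₙ₋₁ ρ α → _≈ₐ_ P α (idAut P))

module _ {n : ℕ} (P : Polytope n) where
  open RankedPosetDefs (Polytope.poset P)

  -- colour-preserving automorphisms of the flag graph (acting on the right)
  record FGAut : Set where
    field
      act    : Flag → Flag
      unact  : Flag → Flag
      act-cong   : ∀ {Φ Ψ} → Φ ≈ Ψ → act Φ ≈ act Ψ
      unact-cong : ∀ {Φ Ψ} → Φ ≈ Ψ → unact Φ ≈ unact Ψ
      act-unact  : ∀ Φ → act (unact Φ) ≈ Φ
      unact-act  : ∀ Φ → unact (act Φ) ≈ Φ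
      act-adj    : ∀ i {Φ Ψ} → Adj i Φ Ψ → Adj i (act Φ) (act Ψ)
      unact-adj  : ∀ i {Φ Ψ} → Adj i Φ Ψ → Adj i (unact Φ) (unact Ψ)
  open FGAut public

  ≈-trans : ∀ Φ Ψ Λ → Φ ≈ Ψ → Ψ ≈ Λ → Φ ≈ Λ
  ≈-trans _ _ _ p q j = trans (p j) (q j)

  fgId : FGAut
  fgId = record { act = λ Φ → Φ ; unact = λ Φ → Φ ; act-cong = λ p → p
                ; unact-cong = λ p → p ; act-unact = λ _ _ → refl
                ; unact-act = λ _ _ → refl ; act-adj = λ _ a → a ; unact-adj = λ _ a → a }

  _⊙_ : FGAut → FGAut → FGAut
  γ ⊙ δ = record
    { act = λ Φ → act δ (act γ Φ)
    ; unact = λ Φ → unact γ (unact δ Φ)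
    ; act-cong = λ p → act-cong δ (act-cong γ p)
    ; unact-cong = λ p → unact-cong γ (unact-cong δ p)
    ; act-unact = λ Φ → ≈-trans (act δ (act γ (unact γ (unact δ Φ)))) (act δ (unact δ Φ)) Φ
                   (act-cong δ {act γ (unact γ (unact δ Φ))} {unact δ Φ} (act-unact γ (unact δ Φ))) (act-unact δ Φ)
    ; unact-act = λ Φ → ≈-trans (unact γ (unact δ (act δ (act γ Φ)))) (unact γ (act γ Φ)) Φ
                   (unact-cong γ {unact δ (act δ (act γ Φ))} {act γ Φ} (unact-act δ (act γ Φ))) (unact-act γ Φ)
    ; act-adj = λ i a → act-adj δ i (act-adj γ i a)
    ; unact-adj = λ i a → unact-adj γ i (unact-adj δ i a) }

  fgInv : FGAut → FGAut
  fgInv γ = record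
    { act = unact γ ; unact = act γ ; act-cong = unact-cong γ ; unact-cong = act-cong γ
    ; act-unact = unact-act γ ; unact-act = act-unact γ
    ; act-adj = unact-adj γ ; unact-adj = act-adj γ }

  record IsSubgroup (G : FGAut → Set) : Set where
    field
      has-id  : G fgId
      has-mul : ∀ {γ δ} → G γ → G δ → G (γ ⊙ δ)
      has-inv : ∀ {γ} → G γ → G (fgInv γ)

module _ {m : ℕ} (P : Polytope (suc m)) where
  open RankedPosetDefs (Polytope.poset P)

  -- facets = connected components of the flag graph after deleting the
  -- edges of colour n-1
  SameFacet : Flag → Flag → Set
  SameFacet = Reach (λ A B → Σ (Fin m) λ k → Adj (inject₁ k) A B)

  RegularOnFacets : (FGAut P → Set) → Set
  RegularOnFacets G =
    (∀ Φ Ψ → Σ (FGAut P) λ γ → G γ × SameFacet (act γ Φ) Ψ) ×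
    (∀ γ → G γ → ∀ Φ → SameFacet (act γ Φ) Φ → ∀ Ψ → act γ Ψ ≈ Ψ)

  CanonicalCayleyExtension : Set₁
  CanonicalCayleyExtension =
    Σ (FGAut P → Set) λ G → IsSubgroup P G × RegularOnFacets G ×
      (∀ Ψ → Σ (FGAut P) λ γ → G γ × Adj (fromℕ m) Ψ (act γ Ψ))

{-# OPTIONS --safe #-}
-- Colour-preserving maps of the flag graph, in particular automorphisms of P, are determined by
-- the image of a single flag. Hence ρ generates Γ(P), Γₙ₋₁ is exactly the stabiliser of the base
-- facet, and Γ(P) = N⁺ₙ₋₁ Γₙ₋₁ with N⁺ₙ₋₁ normal always holds: the FAP amounts to
-- N⁺ₙ₋₁ ∩ Γₙ₋₁ = 1. If the intersection is trivial, N⁺ₙ₋₁ acting on flags by right multiplication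
-- is a canonical Cayley extension group: the factorisation makes it transitive on facets, a
-- facet-stabilising element lies in the intersection, and the (n-1)-edge at Φa is realised by
-- a⁻¹ρₙ₋₁a. Conversely, the element of such a group G moving Φa along its (n-1)-edge acts as
-- a⁻¹ρₙ₋₁a, so G realises all of N⁺ₙ₋₁; an element of N⁺ₙ₋₁ ∩ Γₙ₋₁ fixes the base facet and is
-- therefore trivial because G acts freely on facets.
module Submission where

open import Defs renaming (_·_ to Aut-compose; _⁻¹ to Aut-inverse; _≈ₐ_ to Aut-≈)
open import Data.Nat using (ℕ; zero; suc; z≤n; s≤s; s≤s⁻¹; _≤?_; _<?_)
  renaming (_≤_ to _≤ℕ_; _<_ to _<ℕ_; _+_ to _+ℕ_)
import Data.Nat.Properties as ℕ
open import Data.Fin using (Fin; zero; suc; toℕ; fromℕ; inject₁; opposite)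
  renaming (_<_ to _<F_)
import Data.Fin.Properties as Fin
open import Data.List using (List; []; _∷_; _++_; map)
open import Data.Bool using (Bool; true; false; not)
open import Data.Product using (Σ-syntax; _×_; _,_; proj₁)
open import Data.Sum using (_⊎_; inj₁; inj₂)
open import Function using (_∘_; id)
open import Level using (0ℓ)
open import Relation.Binary.Bundles using (Setoid)
import Relation.Binary.Reasoning.Setoid as SetoidReasoning
open import Relation.Binary.PropositionalEquality
  using (_≡_; _≢_; refl; sym; trans; cong; subst; subst₂; module ≡-Reasoning)
open import Relation.Nullary using (¬_; yes; no; contradiction)

data LastOrInject₁ {m : ℕ} : Fin (suc m) → Set where
  last   : LastOrInject₁ (fromℕ m)
  inject : ∀ k → LastOrInject₁ (inject₁ k)

lastOrInject₁ : ∀ {m} (i : Fin (suc m)) → LastOrInject₁ i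
lastOrInject₁ {zero}  zero    = last
lastOrInject₁ {suc m} zero    = inject zero
lastOrInject₁ {suc m} (suc i) with lastOrInject₁ i
... | last     = last
... | inject k = inject (suc k)

StrictlyIncreasing : ∀ {k l} → (Fin k → Fin l) → Set
StrictlyIncreasing f = ∀ {i j} → i <F j → f i <F f j

strictlyIncreasing-≥ : ∀ {k l} (f : Fin k → Fin l) → StrictlyIncreasing f → ∀ i → toℕ i ≤ℕ toℕ (f i)
strictlyIncreasing-≥ f inc zero    = z≤n
strictlyIncreasing-≥ f inc (suc i) =
  ℕ.≤-<-trans (strictlyIncreasing-≥ (f ∘ inject₁) (inc ∘ inject₁-<) i) (inc (Fin.≤̄⇒inject₁< ℕ.≤-refl))
  where
    inject₁-< : ∀ {k} {i j : Fin k} → i <F j → inject₁ i <F inject₁ j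
    inject₁-< {i = i} {j} = subst₂ _<ℕ_ (sym (Fin.toℕ-inject₁ i)) (sym (Fin.toℕ-inject₁ j))

opposite-< : ∀ {k} {i j : Fin k} → i <F j → opposite j <F opposite i
opposite-< {k} {i} {j} i<j =
  subst₂ _<ℕ_ (sym (Fin.opposite-prop j)) (sym (Fin.opposite-prop i)) (ℕ.∸-monoʳ-< (s≤s i<j) (Fin.toℕ<n j))

strictlyIncreasing⇒≡id : ∀ {k} (f : Fin k → Fin k) → StrictlyIncreasing f → ∀ i → f i ≡ i
strictlyIncreasing⇒≡id f inc i =
  Fin.toℕ-injective (ℕ.≤-antisym (ℕ.≮⇒≥ i≮fi) (strictlyIncreasing-≥ f inc i))
  where
    mirrored-≥ : toℕ (opposite i) ≤ℕ toℕ (opposite (f i))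
    mirrored-≥ = subst (λ t → toℕ (opposite i) ≤ℕ toℕ (opposite (f t))) (Fin.opposite-involutive i)
      (strictlyIncreasing-≥ (opposite ∘ f ∘ opposite) (opposite-< ∘ inc ∘ opposite-<) (opposite i))
    i≮fi : ¬ (i <F f i)
    i≮fi i<fi = ℕ.<⇒≱ (opposite-< i<fi) mirrored-≥

other-of-two-unique : ∀ {A : Set} {z₁ z₂ a b c : A} →
  a ≡ z₁ ⊎ a ≡ z₂ → b ≡ z₁ ⊎ b ≡ z₂ → c ≡ z₁ ⊎ c ≡ z₂ → b ≢ a → c ≢ a → b ≡ c
other-of-two-unique _        (inj₁ b) (inj₁ c) _   _   = trans b (sym c)
other-of-two-unique _        (inj₂ b) (inj₂ c) _   _   = trans b (sym c)
other-of-two-unique (inj₁ a) (inj₁ b) (inj₂ c) b≢a _   = contradiction (trans b (sym a)) b≢a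
other-of-two-unique (inj₂ a) (inj₁ b) (inj₂ c) _   c≢a = contradiction (trans c (sym a)) c≢a
other-of-two-unique (inj₁ a) (inj₂ b) (inj₁ c) _   c≢a = contradiction (trans c (sym a)) c≢a
other-of-two-unique (inj₂ a) (inj₂ b) (inj₁ c) b≢a _   = contradiction (trans b (sym a)) b≢a

splice : {A : Set} → ℕ → (ℕ → A) → (ℕ → A) → ℕ → A
splice r f g k with k ≤? r
... | yes _ = f k
... | no  _ = g k

splice-≤ : ∀ {A : Set} {r k} (f g : ℕ → A) → k ≤ℕ r → splice r f g k ≡ f k
splice-≤ {r = r} {k} _ _ k≤r with k ≤? r
... | yes _   = refl
... | no  k≰r = contradiction k≤r k≰r

splice-> : ∀ {A : Set} {r k} (f g : ℕ → A) → r <ℕ k → splice r f g k ≡ g k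
splice-> {r = r} {k} _ _ r<k with k ≤? r
... | yes k≤r = contradiction k≤r (ℕ.<⇒≱ r<k)
... | no  _   = refl

module FlagGeometry {n : ℕ} (P : Polytope n) where
  open Polytope P
  open RankedPosetDefs poset

  Position : Set
  Position = Fin (suc (suc n))

  -- Record versions of _≈_ and Adj: record types are injective, so Agda infers the flags from a proof.
  infix 4 _≃_
  record _≃_ (Ψ Λ : Flag) : Set where
    constructor mk≃
    field faces : Ψ ≈ Λ
  open _≃_ public

  ≃-setoid : Setoid 0ℓ 0ℓ
  ≃-setoid = record
    { Carrier       = Flag
    ; _≈_           = _≃_
    ; isEquivalence = record
      { refl  = mk≃ λ _ → refl
      ; sym   = λ p → mk≃ λ j → sym (faces p j)
      ; trans = λ p q → mk≃ λ j → trans (faces p j) (faces q j)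
      }
    }
  open Setoid ≃-setoid public using () renaming (refl to ≃-refl; sym to ≃-sym; trans to ≃-trans)
  module ≃-Reasoning = SetoidReasoning ≃-setoid

  record Adjacent (i : Fin n) (Ψ Λ : Flag) : Set where
    constructor mkAdjacent
    field
      agree-off : ∀ j → j ≢ idx i → face Ψ j ≡ face Λ j
      differ-at : face Ψ (idx i) ≢ face Λ (idx i)
  open Adjacent public

  Adj⇒Adjacent : ∀ {i Ψ Λ} → Adj i Ψ Λ → Adjacent i Ψ Λ
  Adj⇒Adjacent (agree , differ) = mkAdjacent agree differ

  Adjacent⇒Adj : ∀ {i Ψ Λ} → Adjacent i Ψ Λ → Adj i Ψ Λ
  Adjacent⇒Adj a = agree-off a , differ-at a

  Adjacent-sym : ∀ {i Ψ Λ} → Adjacent i Ψ Λ → Adjacent i Λ Ψ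
  Adjacent-sym a = mkAdjacent (λ j j≢ → sym (agree-off a j j≢)) (differ-at a ∘ sym)

  Adjacent-resp-≃ : ∀ {i Ψ Ψ′ Λ Λ′} → Ψ ≃ Ψ′ → Λ ≃ Λ′ → Adjacent i Ψ Λ → Adjacent i Ψ′ Λ′
  Adjacent-resp-≃ p q a = mkAdjacent
    (λ j j≢ → trans (sym (faces p j)) (trans (agree-off a j j≢) (faces q j)))
    (λ eq → differ-at a (trans (faces p _) (trans eq (sym (faces q _)))))

  face-< : ∀ Ψ {j k : Position} → j <F k → face Ψ j < face Ψ k
  face-< Ψ {j} {k} j<k = chain Ψ (ℕ.<⇒≤ j<k) , λ eq → Fin.<⇒≢ j<k (rank-face eq)
    where
      rank-face : face Ψ j ≡ face Ψ k → j ≡ k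
      rank-face eq = trans (sym (face-rk Ψ j)) (trans (cong rank eq) (face-rk Ψ k))

  below above : Fin n → Position
  below i = inject₁ (inject₁ i)
  above i = suc (suc i)

  toℕ-below : ∀ i → toℕ (below i) ≡ toℕ i
  toℕ-below i = trans (Fin.toℕ-inject₁ (inject₁ i)) (Fin.toℕ-inject₁ i)

  below<idx : ∀ i → below i <F idx i
  below<idx i = s≤s (ℕ.≤-reflexive (Fin.toℕ-inject₁ (inject₁ i)))

  idx<above : ∀ i → idx i <F above i
  idx<above i = s≤s (s≤s (ℕ.≤-reflexive (Fin.toℕ-inject₁ i)))

  middle-face-choices : ∀ Ψ i → Σ[ z₁ ∈ Face ] Σ[ z₂ ∈ Face ]
    (∀ Λ → face Λ (below i) ≡ face Ψ (below i) → face Λ (above i) ≡ face Ψ (above i) →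
       face Λ (idx i) ≡ z₁ ⊎ face Λ (idx i) ≡ z₂)
  middle-face-choices Ψ i with diamond (face-< Ψ (ℕ.<-trans (below<idx i) (idx<above i))) rank-gap
    where
      rank-gap : toℕ (rank (face Ψ (above i))) ≡ suc (suc (toℕ (rank (face Ψ (below i)))))
      rank-gap = trans (cong toℕ (face-rk Ψ (above i)))
                       (cong (2 +ℕ_) (sym (trans (cong toℕ (face-rk Ψ (below i))) (toℕ-below i))))
  ... | z₁ , z₂ , _ , _ , _ , only = z₁ , z₂ , λ Λ below≡ above≡ → only (face Λ (idx i))
    (subst (_< face Λ (idx i)) below≡ (face-< Λ (below<idx i)))
    (subst (face Λ (idx i) <_) above≡ (face-< Λ (idx<above i)))

  Adjacent-unique : ∀ {i Ψ Λ Λ′} → Adjacent i Ψ Λ → Adjacent i Ψ Λ′ → Λ ≃ Λ′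
  Adjacent-unique {i} {Ψ} {Λ} {Λ′} a a′ = mk≃ same
    where
      outer : ∀ {Θ} → Adjacent i Ψ Θ → ∀ {j} → j ≢ idx i → face Θ j ≡ face Ψ j
      outer b j≢ = sym (agree-off b _ j≢)
      below≢idx : below i ≢ idx i
      below≢idx = Fin.<⇒≢ (below<idx i)
      above≢idx : above i ≢ idx i
      above≢idx = Fin.<⇒≢ (idx<above i) ∘ sym
      same : ∀ j → face Λ j ≡ face Λ′ j
      same j with j Fin.≟ idx i
      ... | no j≢ = trans (outer a j≢) (sym (outer a′ j≢))
      ... | yes refl with middle-face-choices Ψ i
      ... | _ , _ , choice = other-of-two-unique
        (choice Ψ refl refl)
        (choice Λ (outer a below≢idx) (outer a above≢idx))
        (choice Λ′ (outer a′ below≢idx) (outer a′ above≢idx))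
        (differ-at a ∘ sym) (differ-at a′ ∘ sym)

  Reach-map : ∀ {R S : Flag → Flag → Set} → (∀ {Ψ Λ} → R Ψ Λ → S Ψ Λ) →
              ∀ {Ψ Λ} → Reach R Ψ Λ → Reach S Ψ Λ
  Reach-map f (done p)   = done p
  Reach-map f (step r w) = step (f r) (Reach-map f w)

  Step : {I : Set} → (I → Fin n) → Flag → Flag → Set
  Step {I} c Ψ Λ = Σ[ k ∈ I ] Adjacent (c k) Ψ Λ

  module _ {I : Set} {c : I → Fin n} where
    reach-≃ˡ : ∀ {Ψ Ψ′ Λ} → Ψ′ ≃ Ψ → Reach (Step c) Ψ Λ → Reach (Step c) Ψ′ Λ
    reach-≃ˡ p (done q)         = done λ j → trans (faces p j) (q j)
    reach-≃ˡ p (step (k , a) w) = step (k , Adjacent-resp-≃ (≃-sym p) ≃-refl a) w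

    reach-≃ʳ : ∀ {Ψ Λ Λ′} → Reach (Step c) Ψ Λ → Λ ≃ Λ′ → Reach (Step c) Ψ Λ′
    reach-≃ʳ (done q)   p = done λ j → trans (q j) (faces p j)
    reach-≃ʳ (step s w) p = step s (reach-≃ʳ w p)

    reach-trans : ∀ {Ψ Λ Θ} → Reach (Step c) Ψ Λ → Reach (Step c) Λ Θ → Reach (Step c) Ψ Θ
    reach-trans (done q)   w′ = reach-≃ˡ (mk≃ q) w′
    reach-trans (step s w) w′ = step s (reach-trans w w′)

    reach-adjacent : ∀ {k Ψ Λ} → Adjacent (c k) Ψ Λ → Reach (Step c) Ψ Λ
    reach-adjacent a = step (_ , a) (done λ _ → refl)

    reach-sym : ∀ {Ψ Λ} → Reach (Step c) Ψ Λ → Reach (Step c) Λ Ψ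
    reach-sym (done q)         = done λ j → sym (q j)
    reach-sym (step (k , a) w) = reach-trans (reach-sym w) (reach-adjacent (Adjacent-sym a))

  flags-connected : ∀ Ψ Λ → Reach (Step id) Ψ Λ
  flags-connected Ψ Λ = Reach-map (λ (i , a , _) → i , Adj⇒Adjacent a) (strongly-flag-connected Ψ Λ)

  record ColourPreserving : Set where
    field
      apply          : Flag → Flag
      apply-≃        : ∀ {Ψ Λ} → Ψ ≃ Λ → apply Ψ ≃ apply Λ
      apply-Adjacent : ∀ {i Ψ Λ} → Adjacent i Ψ Λ → Adjacent i (apply Ψ) (apply Λ)
  open ColourPreserving public

  colourPreserving-unique : ∀ (f g : ColourPreserving) {Ψ} → apply f Ψ ≃ apply g Ψ →
                            ∀ Λ → apply f Λ ≃ apply g Λ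
  colourPreserving-unique f g {Ψ} fΨ≃gΨ Λ = along (flags-connected Ψ Λ) fΨ≃gΨ
    where
      along : ∀ {Θ Λ} → Reach (Step id) Θ Λ → apply f Θ ≃ apply g Θ → apply f Λ ≃ apply g Λ
      along (done q)         e = ≃-trans (≃-sym (apply-≃ f (mk≃ q))) (≃-trans e (apply-≃ g (mk≃ q)))
      along (step (i , a) w) e = along w
        (Adjacent-unique (apply-Adjacent f a) (Adjacent-resp-≃ (≃-sym e) ≃-refl (apply-Adjacent g a)))

  rk : Face → ℕ
  rk = toℕ ∘ rank

  -- Only the values of at between the ranks of a and b matter.
  record Chain (a b : Face) : Set where
    field
      at       : ℕ → Face
      at-rank  : ∀ k → rk a ≤ℕ k → k ≤ℕ rk b → rk (at k) ≡ k
      at-mono  : ∀ k l → rk a ≤ℕ k → k ≤ℕ l → l ≤ℕ rk b → at k ≤ at l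
      at-start : at (rk a) ≡ a
      at-end   : at (rk b) ≡ b

  Chain-refl : ∀ x → Chain x x
  Chain-refl x = record
    { at = λ _ → x ; at-rank = λ _ → ℕ.≤-antisym ; at-mono = λ _ _ _ _ _ → ≤-refl x
    ; at-start = refl ; at-end = refl }

  Chain-cover : ∀ {a b} → a < b → rk b ≡ suc (rk a) → Chain a b
  Chain-cover {a} {b} a<b covers = record
    { at = at ; at-rank = at-rank ; at-mono = at-mono
    ; at-start = splice-≤ _ _ (ℕ.≤-refl {rk a})
    ; at-end   = splice-> _ _ (subst (rk a <ℕ_) (sym covers) ℕ.≤-refl) }
    where
      at : ℕ → Face
      at = splice (rk a) (λ _ → a) (λ _ → b)
      at-rank : ∀ k → rk a ≤ℕ k → k ≤ℕ rk b → rk (at k) ≡ k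
      at-rank k a≤k k≤b with k ≤? rk a
      ... | yes k≤a = ℕ.≤-antisym a≤k k≤a
      ... | no  k≰a = ℕ.≤-antisym (subst (_≤ℕ k) (sym covers) (ℕ.≰⇒> k≰a)) k≤b
      at-mono : ∀ k l → rk a ≤ℕ k → k ≤ℕ l → l ≤ℕ rk b → at k ≤ at l
      at-mono k l _ k≤l _ with k ≤? rk a | l ≤? rk a
      ... | yes _   | yes _   = ≤-refl a
      ... | yes _   | no  _   = proj₁ a<b
      ... | no  k≰a | yes l≤a = contradiction (ℕ.≤-trans k≤l l≤a) k≰a
      ... | no  _   | no  _   = ≤-refl b

  Chain-glue : ∀ {a z b} → rk a ≤ℕ rk z → rk z ≤ℕ rk b → Chain a z → Chain z b → Chain a b
  Chain-glue {a} {z} {b} a≤z z≤b S T = record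
    { at = at ; at-rank = at-rank ; at-mono = at-mono
    ; at-start = trans (splice-≤ S.at T.at a≤z) S.at-start ; at-end = at-end }
    where
      module S = Chain S
      module T = Chain T
      at : ℕ → Face
      at = splice (rk z) S.at T.at
      at-rank : ∀ k → rk a ≤ℕ k → k ≤ℕ rk b → rk (at k) ≡ k
      at-rank k a≤k k≤b with k ≤? rk z
      ... | yes k≤z = S.at-rank k a≤k k≤z
      ... | no  k≰z = T.at-rank k (ℕ.<⇒≤ (ℕ.≰⇒> k≰z)) k≤b
      at-mono : ∀ k l → rk a ≤ℕ k → k ≤ℕ l → l ≤ℕ rk b → at k ≤ at l
      at-mono k l a≤k k≤l l≤b with k ≤? rk z | l ≤? rk z
      ... | yes _   | yes l≤z = S.at-mono k l a≤k k≤l l≤z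
      ... | yes k≤z | no  l≰z = ≤-trans
        (subst (S.at k ≤_) S.at-end (S.at-mono k (rk z) a≤k k≤z ℕ.≤-refl))
        (subst (_≤ T.at l) T.at-start (T.at-mono (rk z) l ℕ.≤-refl (ℕ.<⇒≤ (ℕ.≰⇒> l≰z)) l≤b))
      ... | no  k≰z | yes l≤z = contradiction (ℕ.≤-trans k≤l l≤z) k≰z
      ... | no  k≰z | no  _   = T.at-mono k l (ℕ.<⇒≤ (ℕ.≰⇒> k≰z)) k≤l l≤b
      at-end : at (rk b) ≡ b
      at-end with rk b ≤? rk z
      ... | no  _   = T.at-end
      ... | yes b≤z = begin
        S.at (rk b) ≡⟨ cong S.at b≡z ⟩
        S.at (rk z) ≡⟨ S.at-end ⟩
        z           ≡⟨ T.at-start ⟨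
        T.at (rk z) ≡⟨ cong T.at b≡z ⟨
        T.at (rk b) ≡⟨ T.at-end ⟩
        b           ∎
        where
          open ≡-Reasoning
          b≡z = ℕ.≤-antisym b≤z z≤b

  Chain-fill : ∀ fuel {a b} → a < b → rk b ≤ℕ rk a +ℕ fuel → Chain a b
  Chain-fill zero {a} {b} a<b bound =
    contradiction (rank-mono a<b) (ℕ.≤⇒≯ (subst (rk b ≤ℕ_) (ℕ.+-identityʳ (rk a)) bound))
  Chain-fill (suc fuel) {a} {b} a<b bound with suc (rk a) <? rk b
  ... | no  no-gap = Chain-cover a<b (ℕ.≤-antisym (ℕ.≮⇒≥ no-gap) (rank-mono a<b))
  ... | yes gap with graded a<b gap
  ... | z , a<z , z<b = Chain-glue (ℕ.<⇒≤ (rank-mono a<z)) (ℕ.<⇒≤ (rank-mono z<b))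
                          (Chain-fill fuel a<z bound-z) (Chain-fill fuel z<b bound-b)
    where
      bound′ : rk b ≤ℕ suc (rk a +ℕ fuel)
      bound′ = subst (rk b ≤ℕ_) (ℕ.+-suc (rk a) fuel) bound
      bound-z : rk z ≤ℕ rk a +ℕ fuel
      bound-z = s≤s⁻¹ (ℕ.<-≤-trans (rank-mono z<b) bound′)
      bound-b : rk b ≤ℕ rk z +ℕ fuel
      bound-b = ℕ.≤-trans bound′ (ℕ.+-monoˡ-≤ fuel (rank-mono a<z))

  chain-from-bottom : ∀ x → Σ[ a ∈ Face ] rk a ≡ 0 × Chain a x
  chain-from-bottom x with rk x ℕ.≟ 0
  ... | yes x₀ = x , x₀ , Chain-refl x
  ... | no  x≢₀ = bottom , cong toℕ bottom-rank ,
    Chain-fill (rk x) (bottom-least x , λ b≡x → x≢₀ (trans (cong rk (sym b≡x)) (cong toℕ bottom-rank)))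
               (ℕ.m≤n+m (rk x) (rk bottom))

  rk-top : rk top ≡ suc n
  rk-top = trans (cong toℕ top-rank) (Fin.toℕ-fromℕ (suc n))

  chain-to-top : ∀ x → Σ[ b ∈ Face ] rk b ≡ suc n × Chain x b
  chain-to-top x with rk x ℕ.≟ suc n
  ... | yes xₙ = x , xₙ , Chain-refl x
  ... | no  x≢ₙ = top , rk-top ,
    Chain-fill (suc n) (top-greatest x , λ x≡t → x≢ₙ (trans (cong rk x≡t) rk-top))
               (subst (_≤ℕ rk x +ℕ suc n) (sym rk-top) (ℕ.m≤n+m (suc n) (rk x)))

  flag-through : ∀ x → Σ[ Ψ ∈ Flag ] face Ψ (rank x) ≡ x
  flag-through x with chain-from-bottom x | chain-to-top x
  ... | a , a₀ , S | b , bₙ , T = Ψ , trans (splice-≤ (Chain.at S) (Chain.at T) ℕ.≤-refl) (Chain.at-end S)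
    where
      module C = Chain (Chain-glue (subst (_≤ℕ rk x) (sym a₀) z≤n)
                                   (subst (rk x ≤ℕ_) (sym bₙ) (Fin.toℕ≤pred[n] (rank x))) S T)
      above-a : ∀ (j : Position) → rk a ≤ℕ toℕ j
      above-a j = subst (_≤ℕ toℕ j) (sym a₀) z≤n
      below-b : ∀ (j : Position) → toℕ j ≤ℕ rk b
      below-b j = subst (toℕ j ≤ℕ_) (sym bₙ) (Fin.toℕ≤pred[n] j)
      Ψ : Flag
      Ψ = record
        { face    = C.at ∘ toℕ
        ; face-rk = λ j → Fin.toℕ-injective (C.at-rank (toℕ j) (above-a j) (below-b j))
        ; chain   = λ {j} {k} j≤k → C.at-mono (toℕ j) (toℕ k) (above-a j) j≤k (below-b k) }

module FlagAction {n : ℕ} (P : Polytope n) where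
  open Polytope P
  open RankedPosetDefs poset
  open FlagGeometry P

  infixl 7 _·_
  _·_ : Aut P → Aut P → Aut P
  _·_ = Aut-compose P

  infix 8 _⁻¹
  _⁻¹ : Aut P → Aut P
  _⁻¹ = Aut-inverse P

  infix 4 _≈ₐ_
  _≈ₐ_ : Aut P → Aut P → Set
  _≈ₐ_ = Aut-≈ P

  fun-injective : ∀ (α : Aut P) {x y} → fun α x ≡ fun α y → x ≡ y
  fun-injective α {x} {y} eq = trans (sym (inv-fun α x)) (trans (cong (inv α) eq) (inv-fun α y))

  fun-< : ∀ (α : Aut P) {x y} → x < y → fun α x < fun α y
  fun-< α (x≤y , x≢y) = fun-mono α x≤y , x≢y ∘ fun-injective α

  rank-fun : ∀ (α : Aut P) Ψ j → rank (fun α (face Ψ j)) ≡ j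
  rank-fun α Ψ = strictlyIncreasing⇒≡id (λ j → rank (fun α (face Ψ j)))
                                        (λ j<k → rank-mono (fun-< α (face-< Ψ j<k)))

  infixl 6 _∙_
  _∙_ : Flag → Aut P → Flag
  Ψ ∙ α = record
    { face    = fun α ∘ face Ψ
    ; face-rk = rank-fun α Ψ
    ; chain   = λ j≤k → fun-mono α (chain Ψ j≤k) }

  ∙-· : ∀ Ψ α β → Ψ ∙ (α · β) ≃ Ψ ∙ α ∙ β
  ∙-· _ _ _ = mk≃ λ _ → refl

  ∙-idAut : ∀ Ψ → Ψ ∙ idAut P ≃ Ψ
  ∙-idAut _ = mk≃ λ _ → refl

  ∙-⁻¹ : ∀ Ψ α → Ψ ∙ α ∙ α ⁻¹ ≃ Ψ
  ∙-⁻¹ Ψ α = mk≃ λ j → inv-fun α (face Ψ j)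

  ∙-≈ₐ : ∀ Ψ {α β} → α ≈ₐ β → Ψ ∙ α ≃ Ψ ∙ β
  ∙-≈ₐ Ψ α≈β = mk≃ λ j → α≈β (face Ψ j)

  ∙-≃ : ∀ α {Ψ Λ} → Ψ ≃ Λ → Ψ ∙ α ≃ Λ ∙ α
  ∙-≃ α p = mk≃ λ j → cong (fun α) (faces p j)

  ∙-Adjacent : ∀ α {i Ψ Λ} → Adjacent i Ψ Λ → Adjacent i (Ψ ∙ α) (Λ ∙ α)
  ∙-Adjacent α a = mkAdjacent (λ j j≢ → cong (fun α) (agree-off a j j≢)) (differ-at a ∘ fun-injective α)

  ∙-reach : ∀ {I} {c : I → Fin n} α {Ψ Λ} → Reach (Step c) Ψ Λ → Reach (Step c) (Ψ ∙ α) (Λ ∙ α)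
  ∙-reach α (done q)         = done λ j → cong (fun α) (q j)
  ∙-reach α (step (k , a) w) = step (k , ∙-Adjacent α a) (∙-reach α w)

  ⁻¹-cong : ∀ {α β} → α ≈ₐ β → α ⁻¹ ≈ₐ β ⁻¹
  ⁻¹-cong {α} {β} α≈β x =
    fun-injective β (trans (sym (α≈β (inv α x))) (trans (fun-inv α x) (sym (fun-inv β x))))

  ·-conjugate : ∀ a σ → a · ((a ⁻¹ · σ) · a) ≈ₐ σ · a
  ·-conjugate a σ x = cong (fun a ∘ fun σ) (inv-fun a x)

  conjugate-≈id : ∀ a α → (a · α) · a ⁻¹ ≈ₐ idAut P → α ≈ₐ idAut P
  conjugate-≈id a α e x = begin
    fun α x                                 ≡⟨ cong (fun α) (fun-inv a x) ⟨
    fun α (fun a (inv a x))                 ≡⟨ fun-inv a _ ⟨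
    fun a (inv a (fun α (fun a (inv a x)))) ≡⟨ cong (fun a) (e (inv a x)) ⟩
    fun a (inv a x)                         ≡⟨ fun-inv a x ⟩
    x                                       ∎
    where open ≡-Reasoning

  autAction : Aut P → ColourPreserving
  autAction α = record { apply = _∙ α ; apply-≃ = ∙-≃ α ; apply-Adjacent = ∙-Adjacent α }

  ≈ₐ-from-flag : ∀ α β Ψ → Ψ ∙ α ≃ Ψ ∙ β → α ≈ₐ β
  ≈ₐ-from-flag α β Ψ e x with flag-through x
  ... | Λ , Λ∋x = begin
    fun α x                      ≡⟨ cong (fun α) Λ∋x ⟨
    fun α (face Λ (rank x))      ≡⟨ faces (colourPreserving-unique (autAction α) (autAction β) {Ψ} e Λ)
                                          (rank x) ⟩
    fun β (face Λ (rank x))      ≡⟨ cong (fun β) Λ∋x ⟩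
    fun β x                      ∎
    where open ≡-Reasoning

  module Words {I : Set} (c : I → Fin n) (σ : I → Aut P) (Φ : Flag)
               (σ-adjacent : ∀ k → Adjacent (c k) Φ (Φ ∙ σ k)) where
    word : List I → Aut P
    word = evalWord P σ

    reach⇒word : ∀ {Ψ Λ} → Reach (Step c) Ψ Λ → ∀ u → Φ ∙ word u ≃ Ψ → Σ[ w ∈ List I ] Φ ∙ word w ≃ Λ
    reach⇒word (done q)         u e = u , ≃-trans e (mk≃ q)
    reach⇒word (step (k , a) w) u e = reach⇒word w (k ∷ u) (≃-trans (∙-· Φ (σ k) (word u))
      (Adjacent-unique (∙-Adjacent (word u) (σ-adjacent k)) (Adjacent-resp-≃ (≃-sym e) ≃-refl a)))

    word⇒reach : ∀ w → Reach (Step c) (Φ ∙ word w) Φ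
    word⇒reach []      = done λ _ → refl
    word⇒reach (k ∷ w) = reach-≃ˡ (∙-· Φ (σ k) (word w)) (reach-trans
      (∙-reach (word w) (reach-adjacent (Adjacent-sym (σ-adjacent k))))
      (word⇒reach w))

  record ActsAs (γ : FGAut P) (α : Aut P) : Set where
    constructor actsAs
    field acts : ∀ Ψ → act γ Ψ ≃ Ψ ∙ α
  open ActsAs public

  graphAction : FGAut P → ColourPreserving
  graphAction γ = record
    { apply          = act γ
    ; apply-≃        = λ {Ψ} {Λ} p → mk≃ (act-cong γ {Ψ} {Λ} (faces p))
    ; apply-Adjacent = λ {i} {Ψ} {Λ} a → Adj⇒Adjacent (act-adj γ i {Ψ} {Λ} (Adjacent⇒Adj a)) }

  rightMultiplication : Aut P → FGAut P
  rightMultiplication α = record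
    { act        = _∙ α
    ; unact      = _∙ α ⁻¹
    ; act-cong   = λ {Ψ} {Λ} p → faces (∙-≃ α (mk≃ {Ψ} {Λ} p))
    ; unact-cong = λ {Ψ} {Λ} p → faces (∙-≃ (α ⁻¹) (mk≃ {Ψ} {Λ} p))
    ; act-unact  = λ Ψ j → fun-inv α (face Ψ j)
    ; unact-act  = λ Ψ → faces (∙-⁻¹ Ψ α)
    ; act-adj    = λ i {Ψ} {Λ} a → Adjacent⇒Adj (∙-Adjacent α (Adj⇒Adjacent {i} {Ψ} {Λ} a))
    ; unact-adj  = λ i {Ψ} {Λ} a → Adjacent⇒Adj (∙-Adjacent (α ⁻¹) (Adj⇒Adjacent {i} {Ψ} {Λ} a)) }

  ActsAs-idAut : ActsAs (fgId P) (idAut P)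
  ActsAs-idAut = actsAs λ Ψ → ≃-sym (∙-idAut Ψ)

  ActsAs-⊙ : ∀ {γ δ α β} → ActsAs γ α → ActsAs δ β → ActsAs (_⊙_ P γ δ) (α · β)
  ActsAs-⊙ {γ} {δ} {α} {β} γα δβ = actsAs λ Ψ → begin
    act δ (act γ Ψ) ≈⟨ apply-≃ (graphAction δ) (acts γα Ψ) ⟩
    act δ (Ψ ∙ α)   ≈⟨ acts δβ (Ψ ∙ α) ⟩
    Ψ ∙ α ∙ β       ≈⟨ ∙-· Ψ α β ⟨
    Ψ ∙ (α · β)     ∎
    where open ≃-Reasoning

  ActsAs-inverse : ∀ {γ α} → ActsAs γ α → ActsAs (fgInv P γ) (α ⁻¹)
  ActsAs-inverse {γ} {α} γα = actsAs λ Ψ → begin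
    unact γ Ψ               ≈⟨ ∙-⁻¹ (unact γ Ψ) α ⟨
    unact γ Ψ ∙ α ∙ α ⁻¹    ≈⟨ ∙-≃ (α ⁻¹) (acts γα (unact γ Ψ)) ⟨
    act γ (unact γ Ψ) ∙ α ⁻¹ ≈⟨ ∙-≃ (α ⁻¹) (mk≃ {act γ (unact γ Ψ)} {Ψ} (act-unact γ Ψ)) ⟩
    Ψ ∙ α ⁻¹                ∎
    where open ≃-Reasoning

  ActsAs-≈ₐ : ∀ {γ α β} → ActsAs γ α → α ≈ₐ β → ActsAs γ β
  ActsAs-≈ₐ {α = α} {β} γα α≈β = actsAs λ Ψ → ≃-trans (acts γα Ψ) (∙-≈ₐ Ψ {α} {β} α≈β)

module FlatAmalgamation {m : ℕ} (P : Polytope (suc m)) (regular : IsRegular P)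
    (Φ : FlagOf P) (ρ : Fin (suc m) → Aut P) (distinguished : IsDistinguishedGens P Φ ρ) where
  open Polytope P
  open RankedPosetDefs poset
  open FlagGeometry P
  open FlagAction P

  ρₙ₋₁ : Aut P
  ρₙ₋₁ = ρ (lastColour P)

  ρ-adjacent : ∀ i → Adjacent i Φ (Φ ∙ ρ i)
  ρ-adjacent i with distinguished i
  ... | Ψ , a , maps = Adjacent-resp-≃ ≃-refl (mk≃ {Ψ} λ j → sym (maps j)) (Adj⇒Adjacent a)

  regular-from-base : ∀ Ψ → Σ[ a ∈ Aut P ] Φ ∙ a ≃ Ψ
  regular-from-base Ψ with regular Φ Ψ
  ... | a , maps = a , mk≃ maps

  SameFacet⇒Reach : ∀ {Ψ Λ} → SameFacet P Ψ Λ → Reach (Step inject₁) Ψ Λ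
  SameFacet⇒Reach = Reach-map λ (k , a) → k , Adj⇒Adjacent a

  Reach⇒SameFacet : ∀ {Ψ Λ} → Reach (Step inject₁) Ψ Λ → SameFacet P Ψ Λ
  Reach⇒SameFacet = Reach-map λ (k , a) → k , Adjacent⇒Adj a

  module Whole = Words id ρ Φ ρ-adjacent
  module Base  = Words inject₁ (ρ ∘ inject₁) Φ (ρ-adjacent ∘ inject₁)

  ρ-generates : ∀ α → Σ[ w ∈ List (Fin (suc m)) ] α ≈ₐ evalWord P ρ w
  ρ-generates α with Whole.reach⇒word (flags-connected Φ (Φ ∙ α)) [] (∙-idAut Φ)
  ... | w , e = w , ≈ₐ-from-flag α (Whole.word w) Φ (≃-sym e)

  facetStabiliser⇒InΓₙ₋₁ : ∀ β → Reach (Step inject₁) (Φ ∙ β) Φ → InΓₙ₋₁ P ρ β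
  facetStabiliser⇒InΓₙ₋₁ β r with Base.reach⇒word (reach-sym r) [] (∙-idAut Φ)
  ... | w , e = w , ≈ₐ-from-flag β (Base.word w) Φ (≃-sym e)

  InΓₙ₋₁⇒facetStabiliser : ∀ β → InΓₙ₋₁ P ρ β → Reach (Step inject₁) (Φ ∙ β) Φ
  InΓₙ₋₁⇒facetStabiliser β (w , e) = reach-≃ˡ (∙-≈ₐ Φ {β} {Base.word w} e) (Base.word⇒reach w)

  conjugate-adjacent : ∀ a {Ψ} → Φ ∙ a ≃ Ψ → Adjacent (lastColour P) Ψ (Ψ ∙ ((a ⁻¹ · ρₙ₋₁) · a))
  conjugate-adjacent a {Ψ} Φa≃Ψ = Adjacent-resp-≃ Φa≃Ψ ρa≃Ψμ (∙-Adjacent a (ρ-adjacent (lastColour P)))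
    where
      μ = (a ⁻¹ · ρₙ₋₁) · a
      ρa≃Ψμ : Φ ∙ ρₙ₋₁ ∙ a ≃ Ψ ∙ μ
      ρa≃Ψμ = begin
        Φ ∙ ρₙ₋₁ ∙ a   ≈⟨ ∙-· Φ ρₙ₋₁ a ⟨
        Φ ∙ (ρₙ₋₁ · a) ≈⟨ ∙-≈ₐ Φ {a · μ} {ρₙ₋₁ · a} (·-conjugate a ρₙ₋₁) ⟨
        Φ ∙ (a · μ)    ≈⟨ ∙-· Φ a μ ⟩
        Φ ∙ a ∙ μ      ≈⟨ ∙-≃ μ Φa≃Ψ ⟩
        Ψ ∙ μ          ∎
        where open ≃-Reasoning

  N⁺ : Aut P → Set
  N⁺ = InN⁺ P ρ

  conjProd-++ : ∀ cs ds → conjProd P ρ (cs ++ ds) ≈ₐ conjProd P ρ cs · conjProd P ρ ds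
  conjProd-++ []                 ds x = refl
  conjProd-++ ((g , true)  ∷ cs) ds x = conjProd-++ cs ds _
  conjProd-++ ((g , false) ∷ cs) ds x = conjProd-++ cs ds _

  inverseConjugates : List (Aut P × Bool) → List (Aut P × Bool)
  inverseConjugates []             = []
  inverseConjugates ((g , b) ∷ cs) = inverseConjugates cs ++ (g , not b) ∷ []

  conjProd-inverseConjugates : ∀ cs → conjProd P ρ (inverseConjugates cs) ≈ₐ conjProd P ρ cs ⁻¹
  conjProd-inverseConjugates [] x = refl
  conjProd-inverseConjugates ((g , true) ∷ cs) x =
    trans (conjProd-++ (inverseConjugates cs) _ x)
          (cong (inv g ∘ inv ρₙ₋₁ ∘ fun g) (conjProd-inverseConjugates cs x))
  conjProd-inverseConjugates ((g , false) ∷ cs) x =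
    trans (conjProd-++ (inverseConjugates cs) _ x)
          (cong (inv g ∘ fun ρₙ₋₁ ∘ fun g) (conjProd-inverseConjugates cs x))

  conjugateConjugates : Aut P → List (Aut P × Bool) → List (Aut P × Bool)
  conjugateConjugates g = map λ (h , b) → g ⁻¹ · h , b

  conjProd-conjugateConjugates : ∀ g cs →
    conjProd P ρ (conjugateConjugates g cs) ≈ₐ (g ⁻¹ · conjProd P ρ cs) · g
  conjProd-conjugateConjugates g [] x = sym (fun-inv g x)
  conjProd-conjugateConjugates g ((h , true) ∷ cs) x =
    trans (conjProd-conjugateConjugates g cs _) (cong (fun g ∘ fun (conjProd P ρ cs)) (inv-fun g _))
  conjProd-conjugateConjugates g ((h , false) ∷ cs) x =
    trans (conjProd-conjugateConjugates g cs _) (cong (fun g ∘ fun (conjProd P ρ cs)) (inv-fun g _))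

  N⁺-· : ∀ {α β} → N⁺ α → N⁺ β → N⁺ (α · β)
  N⁺-· {α} {β} (cs , α≈) (ds , β≈) =
    cs ++ ds , λ x → trans (trans (cong (fun β) (α≈ x)) (β≈ _)) (sym (conjProd-++ cs ds x))

  N⁺-⁻¹ : ∀ {α} → N⁺ α → N⁺ (α ⁻¹)
  N⁺-⁻¹ {α} (cs , α≈) =
    inverseConjugates cs , λ x →
      trans (⁻¹-cong {α} {conjProd P ρ cs} α≈ x) (sym (conjProd-inverseConjugates cs x))

  N⁺-normal : ∀ g ν → N⁺ ν → N⁺ ((g ⁻¹ · ν) · g)
  N⁺-normal g ν (cs , ν≈) =
    conjugateConjugates g cs , λ x →
      trans (cong (fun g) (ν≈ (inv g x))) (sym (conjProd-conjugateConjugates g cs x))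

  N⁺-ρₙ₋₁ : N⁺ ρₙ₋₁
  N⁺-ρₙ₋₁ = (idAut P , true) ∷ [] , λ _ → refl

  Factorisation : Aut P → Set
  Factorisation α = Σ[ ν ∈ Aut P ] Σ[ β ∈ Aut P ] N⁺ ν × InΓₙ₋₁ P ρ β × α ≈ₐ ν · β

  word-factorises : ∀ w → Factorisation (evalWord P ρ w)
  word-factorises [] = idAut P , idAut P , ([] , λ _ → refl) , ([] , λ _ → refl) , λ _ → refl
  word-factorises (i ∷ w) with word-factorises w | lastOrInject₁ i
  ... | ν , β , ν∈N⁺ , β∈Γ , w≈νβ | last =
    ρₙ₋₁ · ν , β , N⁺-· {ρₙ₋₁} {ν} N⁺-ρₙ₋₁ ν∈N⁺ , β∈Γ , w≈νβ ∘ fun ρₙ₋₁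
  ... | ν , β , ν∈N⁺ , (u , β≈u) , w≈νβ | inject k =
    (σ · ν) · σ ⁻¹ , σ · β , N⁺-normal (σ ⁻¹) ν ν∈N⁺ , (k ∷ u , β≈u ∘ fun σ) ,
    λ x → trans (w≈νβ (fun σ x)) (cong (fun β) (sym (fun-inv σ _)))
    where σ = ρ (inject₁ k)

  factorises : ∀ α → Factorisation α
  factorises α with ρ-generates α
  ... | w , α≈w with word-factorises w
  ... | ν , β , ν∈N⁺ , β∈Γ , w≈νβ = ν , β , ν∈N⁺ , β∈Γ , λ x → trans (α≈w x) (w≈νβ x)

  TrivialIntersection : Set
  TrivialIntersection = ∀ α → N⁺ α → InΓₙ₋₁ P ρ α → α ≈ₐ idAut P

  G⁺ : FGAut P → Set
  G⁺ γ = Σ[ α ∈ Aut P ] N⁺ α × ActsAs γ α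

  G⁺-subgroup : IsSubgroup P G⁺
  G⁺-subgroup = record
    { has-id  = idAut P , ([] , λ _ → refl) , ActsAs-idAut
    ; has-mul = λ (α , α∈N⁺ , γα) (β , β∈N⁺ , δβ) → α · β , N⁺-· {α} {β} α∈N⁺ β∈N⁺ , ActsAs-⊙ γα δβ
    ; has-inv = λ (α , α∈N⁺ , γα) → α ⁻¹ , N⁺-⁻¹ {α} α∈N⁺ , ActsAs-inverse γα }

  G⁺-transitive : ∀ Φ′ Ψ′ → Σ[ γ ∈ FGAut P ] G⁺ γ × SameFacet P (act γ Φ′) Ψ′
  G⁺-transitive Φ′ Ψ′ with regular-from-base Φ′ | regular-from-base Ψ′
  ... | a , Φa≃Φ′ | b , Φb≃Ψ′ with factorises (a · b ⁻¹)
  ... | ν , β , ν∈N⁺ , β∈Γ , ab⁻¹≈νβ =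
    rightMultiplication μ , (μ , N⁺-normal a (ν ⁻¹) (N⁺-⁻¹ {ν} ν∈N⁺) , actsAs λ _ → ≃-refl) ,
    Reach⇒SameFacet (reach-≃ˡ Φ′μ≃Φβb (reach-≃ʳ (∙-reach b (InΓₙ₋₁⇒facetStabiliser β β∈Γ)) Φb≃Ψ′))
    where
      μ = (a ⁻¹ · ν ⁻¹) · a
      aμ≈βb : a · μ ≈ₐ β · b
      aμ≈βb x = begin
        fun a (inv ν (inv a (fun a x))) ≡⟨ cong (fun a ∘ inv ν) (inv-fun a x) ⟩
        fun a (inv ν x)                 ≡⟨ fun-inv b _ ⟨
        fun b (inv b (fun a (inv ν x))) ≡⟨ cong (fun b) (ab⁻¹≈νβ (inv ν x)) ⟩
        fun b (fun β (fun ν (inv ν x))) ≡⟨ cong (fun b ∘ fun β) (fun-inv ν x) ⟩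
        fun b (fun β x)                 ∎
        where open ≡-Reasoning
      Φ′μ≃Φβb : Φ′ ∙ μ ≃ Φ ∙ β ∙ b
      Φ′μ≃Φβb = begin
        Φ′ ∙ μ      ≈⟨ ∙-≃ μ Φa≃Φ′ ⟨
        Φ ∙ a ∙ μ   ≈⟨ ∙-· Φ a μ ⟨
        Φ ∙ (a · μ) ≈⟨ ∙-≈ₐ Φ {a · μ} {β · b} aμ≈βb ⟩
        Φ ∙ (β · b) ≈⟨ ∙-· Φ β b ⟩
        Φ ∙ β ∙ b   ∎
        where open ≃-Reasoning

  G⁺-free : TrivialIntersection →
            ∀ γ → G⁺ γ → ∀ Φ′ → SameFacet P (act γ Φ′) Φ′ → ∀ Ψ → act γ Ψ ≈ Ψ
  G⁺-free trivial γ (α , α∈N⁺ , γα) Φ′ γΦ′∼Φ′ Ψ with regular-from-base Φ′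
  ... | a , Φa≃Φ′ = faces (≃-trans (acts γα Ψ) (≃-trans (∙-≈ₐ Ψ {α} {idAut P} α≈id) (∙-idAut Ψ)))
    where
      β = (a · α) · a ⁻¹
      Φaα≃γΦ′ : Φ ∙ a ∙ α ≃ act γ Φ′
      Φaα≃γΦ′ = ≃-trans (∙-≃ α Φa≃Φ′) (≃-sym (acts γα Φ′))
      β-stabilises : Reach (Step inject₁) (Φ ∙ β) Φ
      β-stabilises = reach-≃ˡ (mk≃ λ _ → refl) (reach-≃ʳ
        (∙-reach (a ⁻¹) (reach-≃ˡ Φaα≃γΦ′ (reach-≃ʳ (SameFacet⇒Reach γΦ′∼Φ′) (≃-sym Φa≃Φ′))))
        (∙-⁻¹ Φ a))
      α≈id : α ≈ₐ idAut P
      α≈id = conjugate-≈id a α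
        (trivial β (N⁺-normal (a ⁻¹) α α∈N⁺) (facetStabiliser⇒InΓₙ₋₁ β β-stabilises))

  G⁺-cayley : ∀ Ψ → Σ[ γ ∈ FGAut P ] G⁺ γ × Adj (lastColour P) Ψ (act γ Ψ)
  G⁺-cayley Ψ with regular-from-base Ψ
  ... | a , Φa≃Ψ = rightMultiplication μ ,
    (μ , ((a ⁻¹ , true) ∷ [] , λ _ → refl) , actsAs λ _ → ≃-refl) ,
    Adjacent⇒Adj (conjugate-adjacent a Φa≃Ψ)
    where μ = (a ⁻¹ · ρₙ₋₁) · a

  trivialIntersection⇒CCE : TrivialIntersection → CanonicalCayleyExtension P
  trivialIntersection⇒CCE trivial =
    G⁺ , G⁺-subgroup , (G⁺-transitive , G⁺-free trivial) , G⁺-cayley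

  module Realisation (G : FGAut P → Set) (subgroup : IsSubgroup P G)
      (cayley : ∀ Ψ → Σ[ γ ∈ FGAut P ] G γ × Adj (lastColour P) Ψ (act γ Ψ)) where
    open IsSubgroup subgroup

    Realised : Aut P → Set
    Realised α = Σ[ γ ∈ FGAut P ] G γ × ActsAs γ α

    realised-· : ∀ {α β} → Realised α → Realised β → Realised (α · β)
    realised-· (γ , γ∈G , γα) (δ , δ∈G , δβ) = _⊙_ P γ δ , has-mul γ∈G δ∈G , ActsAs-⊙ γα δβ

    realised-⁻¹ : ∀ {α} → Realised α → Realised (α ⁻¹)
    realised-⁻¹ (γ , γ∈G , γα) = fgInv P γ , has-inv γ∈G , ActsAs-inverse γα

    realised-≈ₐ : ∀ {α β} → Realised α → α ≈ₐ β → Realised β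
    realised-≈ₐ (γ , γ∈G , γα) α≈β = γ , γ∈G , ActsAs-≈ₐ γα α≈β

    -- Both γ and the conjugate send Φ ∙ a to its (n-1)-adjacent flag, so they agree everywhere.
    realised-conjugate : ∀ a → Realised ((a ⁻¹ · ρₙ₋₁) · a)
    realised-conjugate a with cayley (Φ ∙ a)
    ... | γ , γ∈G , adj = γ , γ∈G ,
      actsAs (colourPreserving-unique (graphAction γ) (autAction ((a ⁻¹ · ρₙ₋₁) · a))
                (Adjacent-unique (Adj⇒Adjacent adj) (conjugate-adjacent a ≃-refl)))

    realised-conjProd : ∀ cs → Realised (conjProd P ρ cs)
    realised-conjProd []                 = fgId P , has-id , ActsAs-idAut
    realised-conjProd ((g , true)  ∷ cs) =
      realised-· {(g · ρₙ₋₁) · g ⁻¹} (realised-≈ₐ (realised-conjugate (g ⁻¹)) (λ _ → refl))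
                 (realised-conjProd cs)
    realised-conjProd ((g , false) ∷ cs) =
      realised-· {(g · ρₙ₋₁ ⁻¹) · g ⁻¹}
                 (realised-≈ₐ (realised-⁻¹ (realised-conjugate (g ⁻¹))) (λ _ → refl))
                 (realised-conjProd cs)

    realised-N⁺ : ∀ {α} → N⁺ α → Realised α
    realised-N⁺ (cs , α≈) = realised-≈ₐ (realised-conjProd cs) (sym ∘ α≈)

  CCE⇒trivialIntersection : CanonicalCayleyExtension P → TrivialIntersection
  CCE⇒trivialIntersection (G , subgroup , (_ , free) , cayley) α α∈N⁺ α∈Γ
    with Realisation.realised-N⁺ G subgroup cayley {α} α∈N⁺
  ... | γ , γ∈G , γα = ≈ₐ-from-flag α (idAut P) Φ (begin
    Φ ∙ α       ≈⟨ acts γα Φ ⟨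
    act γ Φ     ≈⟨ mk≃ (free γ γ∈G Φ γΦ∼Φ Φ) ⟩
    Φ           ≈⟨ ∙-idAut Φ ⟨
    Φ ∙ idAut P ∎)
    where
      open ≃-Reasoning
      γΦ∼Φ : SameFacet P (act γ Φ) Φ
      γΦ∼Φ = Reach⇒SameFacet (reach-≃ˡ (acts γα Φ) (InΓₙ₋₁⇒facetStabiliser α α∈Γ))

proposition3p11 : ∀ {m : ℕ} (P : Polytope (suc m)) → IsRegular P →
                    (Φ : FlagOf P) (ρ : Fin (suc m) → Aut P) →
                    IsDistinguishedGens P Φ ρ →
                    (FAP P ρ → CanonicalCayleyExtension P) × (CanonicalCayleyExtension P → FAP P ρ)
proposition3p11 P regular Φ ρ distinguished = fap⇒cce , cce⇒fap
  where
    open FlatAmalgamation P regular Φ ρ distinguished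
    fap⇒cce : FAP P ρ → CanonicalCayleyExtension P
    fap⇒cce (_ , _ , trivial) = trivialIntersection⇒CCE trivial
    cce⇒fap : CanonicalCayleyExtension P → FAP P ρ
    cce⇒fap cce = N⁺-normal , factorises , CCE⇒trivialIntersection cce
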